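{- Let $m>n\ge1$ be coprime, $\alpha=\epsilon_i-\delta_j$, $\lambda\in X_\alpha$, $\Lambda=x(\lambda)$ and $\Lambda^+=\tau_\alpha(\Lambda)$. If $(\Lambda^+,\beta)=0$ for $\beta=\epsilon_i-\delta_k$ with $k\in[m]$, then one of the following holds: (a) $k=j+1$, $\lambda'_j=\lambda'_{j+1}$ and $\beta=\epsilon_i-\delta_{j+1}$; (b) $\alpha=\epsilon_n-\delta_m$, $\beta=\epsilon_n-\delta_1$, $\lambda_1<m$, and $(m,1^{n-1})\subseteq t_\alpha(\lambda)$.
   Context: $X$: partitions $\lambda=(\lambda_1\ge\dots\ge\lambda_n\ge0)$ with $\lambda_1\le m$, drawn in the grid with rows $\epsilon_1,\dots,\epsilon_n$ (top to bottom) and columns $\delta_1,\dots,\delta_m$, with $\lambda_k$ left-justified boxes in row $\epsilon_{n+1-k}$; $\lambda'_j=|\{k:\lambda_k\ge j\}|$; containment is containment of diagrams. $X_\alpha$: those $\lambda$ for which box $\epsilon_i-\delta_j$ is an outer corner; $t_\alpha$ adds that box. Elements of $\mathbb Z^{n|m}$: $(a_1,\dots,a_n|b_1,\dots,b_m)=\sum a_i\epsilon_i-\sum b_j\delta_j$, with $(\Lambda,\epsilon_p-\delta_q)=a_p-b_q$. $x(\lambda)$ has $a_p=m(n-p)+n\lambda_{n+1-p}$, $b_q=n(q-1)+m\lambda'_q$. $\tau_\alpha(\Lambda)=\Lambda+n\epsilon_i-m\delta_j$ (add $n$ to $a_i$ and $m$ to $b_j$). -}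

module Defs where

open import Data.Nat using (ℕ; zero; suc; _+_; _*_; _∸_; _≤_; _<_; _≟_; _≤ᵇ_)
open import Data.Integer as ℤ using (ℤ; +_)
open import Data.Bool using (if_then_else_)
open import Data.Sum using (_⊎_)
open import Relation.Binary.PropositionalEquality using (_≡_)
open import Relation.Nullary.Decidable using (⌊_⌋)

-- A partition λ = (λ₁ ≥ … ≥ λₙ ≥ 0) with λ₁ ≤ m is encoded as a function
-- lam : ℕ → ℕ, where lam k = λ_k for 1 ≤ k ≤ n (values outside [1,n] are
-- never read).
IsPartition : ℕ → ℕ → (ℕ → ℕ) → Set
IsPartition n m lam =
  ((k : ℕ) → 1 ≤ k → k < n → lam (suc k) ≤ lam k) × (1 ≤ n → lam 1 ≤ m)
  where open import Data.Product using (_×_)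

countGE : ℕ → (ℕ → ℕ) → ℕ → ℕ
countGE zero    lam j = 0
countGE (suc c) lam j = (if j ≤ᵇ lam (suc c) then 1 else 0) + countGE c lam j

conj : ℕ → (ℕ → ℕ) → ℕ → ℕ
conj n lam j = countGE n lam j

-- Row ε_i contains λ_{n+1-i} boxes.  Box ε_i - δ_j is an outer corner of λ
-- (i.e. λ ∈ X_α for α = ε_i - δ_j), with k = n+1-i the partition index:
-- λ_k = j - 1 and (k = 1 or λ_{k-1} ≥ j).
InX : ℕ → ℕ → (ℕ → ℕ) → ℕ → ℕ → Set
InX n m lam i j =
  lam (n + 1 ∸ i) + 1 ≡ j × (n + 1 ∸ i ≡ 1 ⊎ j ≤ lam (n ∸ i))
  where open import Data.Product using (_×_)

tAdd : ℕ → (ℕ → ℕ) → ℕ → (ℕ → ℕ)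
tAdd n lam i k = if ⌊ k ≟ n + 1 ∸ i ⌋ then suc (lam k) else lam k

_⊆[_]_ : (ℕ → ℕ) → ℕ → (ℕ → ℕ) → Set
μ ⊆[ n ] ν = (k : ℕ) → 1 ≤ k → k ≤ n → μ k ≤ ν k

hook : ℕ → ℕ → ℕ
hook m k = if ⌊ k ≟ 1 ⌋ then m else 1

-- Elements (a_1,…,a_n | b_1,…,b_m) of ℤ^{n|m}, coordinates indexed from 1.
record Wt : Set where
  constructor wt
  field
    a : ℕ → ℤ
    b : ℕ → ℤ
open Wt public

pairing : Wt → ℕ → ℕ → ℤ
pairing Λ p q = a Λ p ℤ.- b Λ q

x : ℕ → ℕ → (ℕ → ℕ) → Wt
x n m lam = wt (λ p → + (m * (n ∸ p) + n * lam (n + 1 ∸ p)))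
               (λ q → + (n * (q ∸ 1) + m * conj n lam q))

τ : ℕ → ℕ → ℕ → ℕ → Wt → Wt
τ n m i j Λ = wt (λ p → if ⌊ p ≟ i ⌋ then a Λ p ℤ.+ + n else a Λ p)
                 (λ q → if ⌊ q ≟ j ⌋ then b Λ q ℤ.+ + m else b Λ q)

-- Write the pairing as a_i + n = b_k + [k = j] m.  Since row ε_i of λ ends
-- at column j - 1, this reads m(n - i) + n j = n(k - 1) + m (λ'_k + [k = j]),
-- so n j ≡ n (k - 1) mod m and, m and n being coprime, j ≡ k - 1 mod m.
-- With 1 ≤ j ≤ m and 0 ≤ k - 1 < m this leaves k = j + 1, and then
-- λ'_{j+1} = n - i = λ'_j because ε_i - δ_j is a corner; or j = m, k = 1,
-- and then λ'_1 = n - i + n ≤ n forces i = n and every row to be nonempty.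
module Submission where

open import Defs
open import Data.Nat using (ℕ; _≤_; _<_; _+_)
open import Data.Nat.Coprimality using (Coprime)
open import Data.Integer using (ℤ; +_)
open import Data.Product using (_×_)
open import Data.Sum using (_⊎_)
open import Relation.Binary.PropositionalEquality using (_≡_)

open import Data.Nat using (zero; suc; _*_; _∸_; _≟_; _≤ᵇ_; _≤′_; ≤′-refl; ≤′-step; z≤n; s≤s; NonZero)
open import Data.Nat.Properties
open import Data.Nat.Divisibility using (divides)
open import Data.Nat.Coprimality using (coprime-divisor)
import Data.Integer.Properties as ℤ
open import Data.Bool using (true; false; if_then_else_)
open import Data.Product using (∃; _,_; proj₁)
open import Data.Sum using (inj₁; inj₂)
open import Relation.Binary.PropositionalEquality using (refl; sym; trans; cong; subst; _≢_; module ≡-Reasoning)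
open import Relation.Nullary using (yes; no; ofʸ; ofⁿ; contradiction)
open import Relation.Nullary.Decidable using (⌊_⌋)
open import Data.Nat.Solver using (module +-*-Solver)
open +-*-Solver using (solve; _:+_; _:*_; _:=_; con)

𝟙[_≡_] : ℕ → ℕ → ℕ
𝟙[ k ≡ j ] = if ⌊ k ≟ j ⌋ then 1 else 0

+-𝟙-≢ : ∀ c {k j} → k ≢ j → c + 𝟙[ k ≡ j ] ≡ c
+-𝟙-≢ c {k} {j} k≢j with k ≟ j
... | yes k≡j = contradiction k≡j k≢j
... | no _    = +-identityʳ c

coprime-cancel : ∀ {m n e d} .{{_ : NonZero m}} → Coprime m n → m * e ≡ n * d → ∃ λ f → d ≡ f * m × e ≡ f * n
coprime-cancel {m} {n} {e} {d} m⊥n me≡nd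
  with coprime-divisor m⊥n (divides e (trans (sym me≡nd) (*-comm m e)))
... | divides f refl = f , refl , *-cancelˡ-≡ e (f * n) m (begin
  m * e        ≡⟨ me≡nd ⟩
  n * (f * m)  ≡⟨ solve 3 (λ m n f → n :* (f :* m) := m :* (f :* n)) refl m n f ⟩
  m * (f * n)  ∎)
  where open ≡-Reasoning

coprime-multiple : ∀ {m n X d c} .{{_ : NonZero m}} → Coprime m n →
  m * X ≡ n * d + m * c → ∃ λ f → d ≡ f * m × X ≡ c + f * n
coprime-multiple {m} {n} {X} {d} {c} m⊥n eq with m≤n⇒∃[o]m+o≡n c≤X
  where
  c≤X : c ≤ X
  c≤X = *-cancelˡ-≤ m (subst (m * c ≤_) (sym eq) (m≤n+m (m * c) (n * d)))
... | e , refl with coprime-cancel m⊥n (+-cancelˡ-≡ (m * c) (m * e) (n * d) (begin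
  m * c + m * e   ≡⟨ sym (*-distribˡ-+ m c e) ⟩
  m * (c + e)     ≡⟨ eq ⟩
  n * d + m * c   ≡⟨ +-comm (n * d) (m * c) ⟩
  m * c + n * d   ∎))
  where open ≡-Reasoning
...   | f , d≡fm , e≡fn = f , d≡fm , cong (λ t → c + t) e≡fn

-- n j ≡ n k mod m forces j ≡ k mod m, and the representatives j ∈ [1, m], k ∈ [0, m) leave only these two cases.
coprime-residue : ∀ {m n X j k c} → Coprime m n → 1 ≤ j → j ≤ m → k < m →
  m * X + n * j ≡ n * k + m * c →
  (k ≡ j × X ≡ c) ⊎ (j ≡ m × k ≡ 0 × X + n ≡ c)
coprime-residue {m@(suc _)} {n} {X} {j} {k} {c} m⊥n 1≤j j≤m k<m eq with ≤-total j k
... | inj₁ j≤k with m≤n⇒∃[o]m+o≡n j≤k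
...   | d , refl with coprime-multiple {X = X} {d} {c} m⊥n (+-cancelˡ-≡ (n * j) _ _ (begin
  n * j + m * X            ≡⟨ +-comm (n * j) (m * X) ⟩
  m * X + n * j            ≡⟨ eq ⟩
  n * (j + d) + m * c      ≡⟨ solve 4 (λ n j d mc → n :* (j :+ d) :+ mc := n :* j :+ (n :* d :+ mc)) refl n j d (m * c) ⟩
  n * j + (n * d + m * c)  ∎))
  where open ≡-Reasoning
...     | zero  , refl , refl = inj₁ (+-identityʳ j , +-identityʳ c)
...     | suc f , refl , _    = contradiction (≤-trans (m≤m+n m (f * m)) (m≤n+m _ j)) (<⇒≱ k<m)
coprime-residue {m@(suc _)} {n} {X} {j} {k} {c} m⊥n 1≤j j≤m k<m eq | inj₂ k≤j with m≤n⇒∃[o]m+o≡n k≤j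
... | d , refl with coprime-multiple {X = c} {d} {X} m⊥n (+-cancelˡ-≡ (n * k) _ _ (begin
  n * k + m * c            ≡⟨ sym eq ⟩
  m * X + n * (k + d)      ≡⟨ solve 4 (λ n k d mX → mX :+ n :* (k :+ d) := n :* k :+ (n :* d :+ mX)) refl n k d (m * X) ⟩
  n * k + (n * d + m * X)  ∎))
  where open ≡-Reasoning
...   | zero , refl , refl = inj₁ (sym (+-identityʳ k) , sym (+-identityʳ X))
...   | suc zero , refl , refl = inj₂ (k+m≡m , k≡0 , cong (λ t → X + t) (sym (*-identityˡ n)))
  where
  k+m≤m : k + 1 * m ≤ 0 + 1 * m
  k+m≤m = subst (k + 1 * m ≤_) (sym (*-identityˡ m)) j≤m
  k≡0 : k ≡ 0
  k≡0 = n≤0⇒n≡0 (+-cancelʳ-≤ (1 * m) k 0 k+m≤m)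
  k+m≡m : k + 1 * m ≡ m
  k+m≡m = trans (cong (_+ 1 * m) k≡0) (*-identityˡ m)
...   | suc (suc f) , refl , _ = contradiction (≤-trans (m≤n+m _ k) j≤m) (<⇒≱ (m<m+n m (s≤s z≤n)))

countGE-≤ : ∀ c lam j → countGE c lam j ≤ c
countGE-≤ zero    lam j = z≤n
countGE-≤ (suc c) lam j with j ≤ᵇ lam (suc c)
... | true  = s≤s (countGE-≤ c lam j)
... | false = m≤n⇒m≤1+n (countGE-≤ c lam j)

countGE-≡⇒≥ : ∀ c lam j → countGE c lam j ≡ c → ∀ k → 1 ≤ k → k ≤ c → j ≤ lam k
countGE-≡⇒≥ zero    lam j eq (suc k) 1≤k ()
countGE-≡⇒≥ (suc c) lam j eq k 1≤k k≤c
  with j ≤ᵇ lam (suc c) | ≤ᵇ-reflects-≤ j (lam (suc c)) | m≤n⇒m<n∨m≡n k≤c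
... | false | _        | _             = contradiction eq (<⇒≢ (s≤s (countGE-≤ c lam j)))
... | true  | ofʸ j≤l  | inj₂ refl     = j≤l
... | true  | _        | inj₁ (s≤s k≤c′) = countGE-≡⇒≥ c lam j (suc-injective eq) k 1≤k k≤c′

countGE-threshold : ∀ c r lam j → r ≤ c →
  (∀ k → 1 ≤ k → k ≤ r → j ≤ lam k) → (∀ k → r < k → k ≤ c → lam k < j) →
  countGE c lam j ≡ r
countGE-threshold zero    .zero lam j z≤n above below = refl
countGE-threshold (suc c) r     lam j r≤c above below
  with j ≤ᵇ lam (suc c) | ≤ᵇ-reflects-≤ j (lam (suc c)) | m≤n⇒m<n∨m≡n r≤c
... | true  | _         | inj₂ refl =
      cong suc (countGE-threshold c c lam j ≤-refl (λ k 1≤k k≤c → above k 1≤k (m≤n⇒m≤1+n k≤c))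
                 (λ k c<k k≤c → contradiction k≤c (<⇒≱ c<k)))
... | true  | ofʸ j≤l  | inj₁ r<c = contradiction j≤l (<⇒≱ (below (suc c) r<c ≤-refl))
... | false | _         | inj₁ (s≤s r≤c′) =
      countGE-threshold c r lam j r≤c′ above (λ k r<k k≤c → below k r<k (m≤n⇒m≤1+n k≤c))
... | false | ofⁿ j≰l  | inj₂ refl = contradiction (above (suc c) (s≤s z≤n) ≤-refl) j≰l

partition-antitone : ∀ {n m lam a b} → IsPartition n m lam → 1 ≤ a → a ≤ b → b ≤ n → lam b ≤ lam a
partition-antitone {n} {lam = lam} {a} P 1≤a a≤b = go (≤⇒≤′ a≤b)
  where
  go : ∀ {b} → a ≤′ b → b ≤ n → lam b ≤ lam a
  go ≤′-refl             _     = ≤-refl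
  go (≤′-step {b} a≤′b) 1+b≤n =
    ≤-trans (proj₁ P b (≤-trans 1≤a (≤′⇒≤ a≤′b)) 1+b≤n) (go a≤′b (<⇒≤ 1+b≤n))

-- Row ε_i is row n - i + 1 of the partition, so at a corner exactly the n - i rows above it reach column j.
corner-conj : ∀ {n m lam i j} → IsPartition n m lam → InX n m lam i j → i ≤ n → conj n lam j ≡ n ∸ i
corner-conj {n} {lam = lam} {i} {j} P (row , top-or-above) i≤n =
  countGE-threshold n (n ∸ i) lam j (m∸n≤m n i) (above top-or-above) below
  where
  row-index : n + 1 ∸ i ≡ suc (n ∸ i)
  row-index = trans (+-∸-comm 1 i≤n) (+-comm (n ∸ i) 1)
  row′ : lam (suc (n ∸ i)) + 1 ≡ j
  row′ = subst (λ r → lam r + 1 ≡ j) row-index row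
  above : n + 1 ∸ i ≡ 1 ⊎ j ≤ lam (n ∸ i) → ∀ k → 1 ≤ k → k ≤ n ∸ i → j ≤ lam k
  above (inj₁ top) k 1≤k k≤r =
    contradiction (≤-trans 1≤k (subst (k ≤_) (suc-injective (trans (sym row-index) top)) k≤r)) (λ ())
  above (inj₂ j≤l) k 1≤k k≤r = ≤-trans j≤l (partition-antitone P 1≤k k≤r (m∸n≤m n i))
  below : ∀ k → n ∸ i < k → k ≤ n → lam k < j
  below k r<k k≤n = subst (lam k <_) (trans (+-comm 1 _) row′) (s≤s (partition-antitone P (s≤s z≤n) r<k k≤n))

τx-pairing-zero : ∀ n m lam i j k → pairing (τ n m i j (x n m lam)) i k ≡ + 0 →
  m * (n ∸ i) + n * lam (n + 1 ∸ i) + n ≡ n * (k ∸ 1) + m * conj n lam k + m * 𝟙[ k ≡ j ]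
τx-pairing-zero n m lam i j k h with i ≟ i | k ≟ j
... | no i≢i | _     = contradiction refl i≢i
... | yes _  | yes _ = trans (ℤ.+-injective (ℤ.i-j≡0⇒i≡j _ _ h)) (cong (λ t → b-part + t) (sym (*-identityʳ m)))
  where b-part = n * (k ∸ 1) + m * conj n lam k
... | yes _  | no _  = begin
  m * (n ∸ i) + n * lam (n + 1 ∸ i) + n ≡⟨ ℤ.+-injective (ℤ.i-j≡0⇒i≡j _ _ h) ⟩
  b-part                                ≡⟨ sym (+-identityʳ b-part) ⟩
  b-part + 0                            ≡⟨ cong (λ t → b-part + t) (sym (*-zeroʳ m)) ⟩
  b-part + m * 0                        ∎
  where b-part = n * (k ∸ 1) + m * conj n lam k
        open ≡-Reasoning

corner-pairing-zero : ∀ n m lam i j k → lam (n + 1 ∸ i) + 1 ≡ j →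
  pairing (τ n m i j (x n m lam)) i k ≡ + 0 →
  m * (n ∸ i) + n * j ≡ n * (k ∸ 1) + m * (conj n lam k + 𝟙[ k ≡ j ])
corner-pairing-zero n m lam i j k row h = begin
  m * (n ∸ i) + n * j                        ≡⟨ cong (λ t → m * (n ∸ i) + n * t) (sym row) ⟩
  m * (n ∸ i) + n * (l + 1)                  ≡⟨ solve 4 (λ m r n l → m :* r :+ n :* (l :+ con 1) := m :* r :+ n :* l :+ n) refl m (n ∸ i) n l ⟩
  m * (n ∸ i) + n * l + n                    ≡⟨ τx-pairing-zero n m lam i j k h ⟩
  n * (k ∸ 1) + m * c + m * 𝟙[ k ≡ j ]       ≡⟨ +-assoc (n * (k ∸ 1)) (m * c) _ ⟩
  n * (k ∸ 1) + (m * c + m * 𝟙[ k ≡ j ])     ≡⟨ cong (λ t → n * (k ∸ 1) + t) (sym (*-distribˡ-+ m c _)) ⟩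
  n * (k ∸ 1) + m * (c + 𝟙[ k ≡ j ])         ∎
  where
  open ≡-Reasoning
  l = lam (n + 1 ∸ i)
  c = conj n lam k

hook⊆tAdd-first-row : ∀ {n m lam} → suc (lam 1) ≡ m → (∀ k → 1 ≤ k → k ≤ n → 1 ≤ lam k) →
  hook m ⊆[ n ] tAdd n lam n
hook⊆tAdd-first-row {n} {lam = lam} row nonempty k 1≤k k≤n
  rewrite m+n∸m≡n n 1 with k ≟ 1
... | yes refl = ≤-reflexive (sym row)
... | no _     = nonempty k 1≤k k≤n

last-column-corner : ∀ {n m lam i} → InX n m lam i m → i ≤ n → n ∸ i + n ≡ conj n lam 1 →
  i ≡ n × lam 1 < m × hook m ⊆[ n ] tAdd n lam i
last-column-corner {n} {m} {lam} {i} (row , _) i≤n eq with ≤-antisym i≤n (m∸n≡0⇒m≤n n∸i≡0)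
  where
  n∸i≡0 : n ∸ i ≡ 0
  n∸i≡0 = n≤0⇒n≡0 (+-cancelʳ-≤ n (n ∸ i) 0 (subst (_≤ n) (sym eq) (countGE-≤ n lam 1)))
... | refl = refl , subst (lam 1 <_) first-row ≤-refl ,
             hook⊆tAdd-first-row first-row (countGE-≡⇒≥ n lam 1 all-rows)
  where
  first-row : suc (lam 1) ≡ m
  first-row = trans (+-comm 1 (lam 1)) (subst (λ r → lam r + 1 ≡ m) (m+n∸m≡n n 1) row)
  all-rows : conj n lam 1 ≡ n
  all-rows = trans (sym eq) (cong (_+ n) (n∸n≡0 n))

lemma4p7 : (n m : ℕ) → 1 ≤ n → n < m → Coprime m n →
    (i j k : ℕ) → 1 ≤ i → i ≤ n → 1 ≤ j → j ≤ m → 1 ≤ k → k ≤ m →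
    (lam : ℕ → ℕ) → IsPartition n m lam → InX n m lam i j →
    pairing (τ n m i j (x n m lam)) i k ≡ + 0 →
    (k ≡ j + 1 × conj n lam j ≡ conj n lam (j + 1))
    ⊎ (i ≡ n × j ≡ m × k ≡ 1 × lam 1 < m × hook m ⊆[ n ] tAdd n lam i)
lemma4p7 n m 1≤n n<m m⊥n i j (suc k) _ i≤n 1≤j j≤m _ k<m lam P corner h
  with coprime-residue m⊥n 1≤j j≤m k<m (corner-pairing-zero n m lam i j (suc k) (proj₁ corner) h)
... | inj₁ (refl , X≡c) = inj₁ (+-comm 1 j , (begin
  conj n lam j                          ≡⟨ corner-conj P corner i≤n ⟩
  n ∸ i                                 ≡⟨ X≡c ⟩
  conj n lam (suc j) + 𝟙[ suc j ≡ j ]   ≡⟨ +-𝟙-≢ _ (>⇒≢ (n<1+n j)) ⟩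
  conj n lam (suc j)                    ≡⟨ cong (conj n lam) (+-comm 1 j) ⟩
  conj n lam (j + 1)                    ∎))
  where open ≡-Reasoning
... | inj₂ (refl , refl , X+n≡c) =
  let i≡n , last-row = last-column-corner corner i≤n (trans X+n≡c (+-𝟙-≢ _ 1≢m))
  in  inj₂ (i≡n , refl , refl , last-row)
  where
  1≢m : 1 ≢ m
  1≢m = <⇒≢ (≤-trans (s≤s 1≤n) n<m)
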